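{- Let $n$ be a positive integer, $\perp\!\!\!\perp$ a pole, $t_1,\dots,t_n$ terms and $\pi$ a stack. Then $t_1\cdot\ldots\cdot t_n\cdot\pi\in\|\gimel_2\models\mathrm{A}_n\|_{\perp\!\!\!\perp}$ if and only if at most one of the $t_i$ does not realize $\bot$ with respect to $\perp\!\!\!\perp$.
   Context: $\lambda_c$-calculus. Fix a countably infinite set of variables. $\lambda_c$-terms: $t,u ::= x \mid tu \mid \lambda x.t \mid \mathrm{cc} \mid k_\pi$ ($\pi$ a stack) $\mid \kappa_m$ ($m\in\mathbb{N}$) $\mid \beta_m$ ($m\in\mathbb{N}$), modulo $\alpha$-equivalence. A term is a closed $\lambda_c$-term; $\Lambda$ the set of terms. Stacks: $\pi ::= \omega_m \mid t\cdot\pi$; $\Pi$ the set of stacks. Processes: $t\star\pi$. One-step evaluation $\succ_1$: $tu\star\pi \succ_1 t\star u\cdot\pi$, $\lambda x.t\star u\cdot\pi\succ_1 t[x:=u]\star\pi$, $\mathrm{cc}\star t\cdot\pi\succ_1 t\star k_\pi\cdot\pi$, $k_{\pi'}\star t\cdot\pi\succ_1 t\star\pi'$; $\succ$ its reflexive-transitive closure. A pole is a set $\perp\!\!\!\perp$ of processes with $p\succ q$, $q\in\perp\!\!\!\perp\Rightarrow p\in\perp\!\!\!\perp$. Formulas. First-order terms: $a ::= x \mid f(a_1,\dots,a_k)$ ($f:\mathbb{N}^k\to\mathbb{N}$). Formulas: $X(a_1,\dots,a_k)\mid\top\mid\bot\mid A\to B\mid\forall xA\mid\forall XA\mid(a=b)\hookrightarrow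 A\mid A\cap B\mid A\cup B\mid F(a_1,\dots,a_k)$. For the pole $\perp\!\!\!\perp$: $\|\top\|_{\perp\!\!\!\perp}=\emptyset$, $\|\bot\|_{\perp\!\!\!\perp}=\Pi$, $\|A\to B\|=\{t\cdot\pi:t\in|A|,\pi\in\|B\|\}$, $\|\forall xA\|=\bigcup_m\|A[x:=m]\|$, $\|\forall XA\|=\bigcup_F\|A[X:=F]\|$, $\|(a=b)\hookrightarrow A\|=\|A\|$ if the values of $a,b$ are equal else $\emptyset$, $\|A\cap B\|=\|A\|\cup\|B\|$, $\|A\cup B\|=\|A\|\cap\|B\|$, $\|F(\vec a)\|=F(\text{values})$; $|A|=\{t:\forall\pi\in\|A\|,t\star\pi\in\perp\!\!\!\perp\}$; $t$ realizes $A$ if $t\in|A|$. Abbreviations: $a=b$ is $\forall Z(Z(a)\to Z(b))$; $a\ne b$ is $(a=b)\hookrightarrow\bot$. On $\mathbb{N}$: $m\vee n=1$ if $m>0$ or $n>0$, else $0$; $m\wedge n=1$ if both $>0$, else $0$. $\gimel_2(a)$ is the formula $\min(a+1,2)=a+1$. $\gimel_2\models\mathrm{A}_n$ is the formula $\forall x_1\dots\forall x_n\ \gimel_2(x_1)\hookrightarrow\cdots\hookrightarrow\gimel_2(x_n)\hookrightarrow\big(x_1\ne0\to\cdots\to x_n\ne0\to(\bigvee_{i\ne j}x_i\wedge x_j)\ne0\big)$, where $\bigvee,\wedge$ in the last inequation are the operations on $\mathbb{N}$ above. -}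

module Defs where

open import Data.Nat using (ℕ; zero; suc; _⊓_; _≤_)
open import Data.Fin using (Fin; zero; suc)
open import Data.Fin.Properties using () renaming (_≟_ to _≟ᶠ_)
open import Data.Vec using (Vec; []; _∷_; lookup)
open import Data.Product using (Σ; _×_)
open import Data.Unit using (⊤)
open import Data.Empty using (⊥)
open import Relation.Binary.PropositionalEquality using (_≡_)
open import Relation.Binary.Construct.Closure.ReflexiveTransitive using (Star)
open import Relation.Nullary using (yes; no)

-- λc-terms (de Bruijn indices; Term n = terms with ≤ n free variables,
-- so α-equivalence is built in; closed terms are Term 0) and stacks.

data Stack : Set
data Term (n : ℕ) : Set

data Term n where
  var : Fin n → Term n
  app : Term n → Term n → Term n
  lam : Term (suc n) → Term n
  cc  : Term n
  k   : Stack → Term n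
  κ   : ℕ → Term n
  β   : ℕ → Term n

infixr 5 _·_
data Stack where
  ω   : ℕ → Stack
  _·_ : Term 0 → Stack → Stack

Λ : Set
Λ = Term 0

ext : ∀ {m n} → (Fin m → Fin n) → Fin (suc m) → Fin (suc n)
ext ρ zero    = zero
ext ρ (suc i) = suc (ρ i)

rename : ∀ {m n} → (Fin m → Fin n) → Term m → Term n
rename ρ (var i)   = var (ρ i)
rename ρ (app t u) = app (rename ρ t) (rename ρ u)
rename ρ (lam t)   = lam (rename (ext ρ) t)
rename ρ cc        = cc
rename ρ (k π)     = k π
rename ρ (κ m)     = κ m
rename ρ (β m)     = β m

exts : ∀ {m n} → (Fin m → Term n) → Fin (suc m) → Term (suc n)
exts σ zero    = var zero
exts σ (suc i) = rename suc (σ i)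

subst : ∀ {m n} → (Fin m → Term n) → Term m → Term n
subst σ (var i)   = σ i
subst σ (app t u) = app (subst σ t) (subst σ u)
subst σ (lam t)   = lam (subst (exts σ) t)
subst σ cc        = cc
subst σ (k π)     = k π
subst σ (κ m)     = κ m
subst σ (β m)     = β m

_[_] : Term 1 → Term 0 → Term 0
t [ u ] = subst (λ { zero → u }) t

infix 4 _⋆_
record Process : Set where
  constructor _⋆_
  field
    term  : Λ
    stack : Stack

infix 3 _≻₁_ _≻_
data _≻₁_ : Process → Process → Set where
  push    : ∀ {t u π}    → app t u ⋆ π    ≻₁ t ⋆ u · π
  grab    : ∀ {t u π}    → lam t ⋆ u · π  ≻₁ t [ u ] ⋆ π
  save    : ∀ {t π}      → cc ⋆ t · π     ≻₁ t ⋆ k π · π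
  restore : ∀ {π′ t π}   → k π′ ⋆ t · π   ≻₁ t ⋆ π′

_≻_ : Process → Process → Set
_≻_ = Star _≻₁_

IsPole : (Process → Set) → Set
IsPole ⫫ = ∀ {p q} → p ≻ q → ⫫ q → ⫫ p

-- Falsity values (shallow embedding of the clauses for ‖_‖ used here)
-- A falsity value is a set of stacks.

FV : Set₁
FV = Stack → Set

module Realizability (⫫ : Process → Set) where

  ∣_∣ : FV → Λ → Set
  ∣ A ∣ t = ∀ π → A π → ⫫ (t ⋆ π)

  ‖⊥‖ : FV
  ‖⊥‖ _ = ⊤

  _⇒_ : FV → FV → FV
  (A ⇒ B) (ω _)   = ⊥
  (A ⇒ B) (t · π) = ∣ A ∣ t × B π
  infixr 4 _⇒_

  ∀ₓ : (ℕ → FV) → FV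
  ∀ₓ A π = Σ ℕ λ m → A m π

  _↪_ : ℕ × ℕ → FV → FV
  (ab ↪ A) π = (Data.Product.proj₁ ab ≡ Data.Product.proj₂ ab) × A π
  infixr 4 _↪_

  ≠ : ℕ → ℕ → FV
  ≠ a b = (a Data.Product., b) ↪ ‖⊥‖

_∨ℕ_ : ℕ → ℕ → ℕ
zero  ∨ℕ zero  = 0
zero  ∨ℕ suc _ = 1
suc _ ∨ℕ _     = 1

_∧ℕ_ : ℕ → ℕ → ℕ
suc _ ∧ℕ suc _ = 1
_     ∧ℕ _     = 0

⋁ : ∀ n → (Fin n → ℕ) → ℕ
⋁ zero    f = 0
⋁ (suc n) f = f zero ∨ℕ ⋁ n (λ i → f (suc i))

⋁pairs : ∀ {n} → Vec ℕ n → ℕ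
⋁pairs {n} xs = ⋁ n λ i → ⋁ n λ j → pairTerm i j
  where
  pairTerm : Fin n → Fin n → ℕ
  pairTerm i j with i ≟ᶠ j
  ... | yes _ = 0
  ... | no  _ = lookup xs i ∧ℕ lookup xs j

module Aleph (⫫ : Process → Set) where
  open Realizability ⫫

  ℶ₂ : ℕ → ℕ × ℕ
  ℶ₂ a = (suc a ⊓ 2) Data.Product., suc a

  ∀ₓⁿ : ∀ n → (Vec ℕ n → FV) → FV
  ∀ₓⁿ zero    F = F []
  ∀ₓⁿ (suc n) F = ∀ₓ λ m → ∀ₓⁿ n λ xs → F (m ∷ xs)

  hooks : ∀ {n} → Vec ℕ n → FV → FV
  hooks []       B = B
  hooks (x ∷ xs) B = ℶ₂ x ↪ hooks xs B

  arrows : ∀ {n} → Vec ℕ n → FV → FV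
  arrows []       C = C
  arrows (x ∷ xs) C = ≠ x 0 ⇒ arrows xs C

  ‖ℶ₂⊨A‖ : ℕ → FV
  ‖ℶ₂⊨A‖ n = ∀ₓⁿ n λ xs → hooks xs (arrows xs (≠ (⋁pairs xs) 0))

pushAll : ∀ {n} → Vec Λ n → Stack → Stack
pushAll []       π = π
pushAll (t ∷ ts) π = t · pushAll ts π

module Submission where

-- Unfolding the quantifiers, ‖ℶ₂ ⊨ Aₙ‖ contains t₁ · … · tₙ · π exactly when
-- some vector of bits x₁ … xₙ ∈ {0,1} has tᵢ ∈ |xᵢ ≠ 0| for every i and
-- ⋁_{i≠j} xᵢ ∧ xⱼ = 0 (lemma `membership`).  Three independent facts finish
-- the argument:
--   * ⋁_{i≠j} xᵢ ∧ xⱼ = 0 iff at most one xᵢ is non-zero (`⋁pairs≡0⇔`);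
--   * |x ≠ 0| is |⊥| when x = 0 and is all of Λ when x ≠ 0;
--   * if among any two distinct indices one satisfies P, then P holds
--     everywhere except at one index (`allButOne`).
-- Forwards, two distinct indices cannot both carry a bit 1, so one of them
-- carries 0 and its term realizes ⊥.  Backwards, the indicator vector of the
-- exceptional index is a suitable bit vector.

open import Defs
open import Data.Nat using (ℕ; zero; suc; _⊓_; _≤_; s≤s; z≤n)
open import Data.Nat.Properties using () renaming (_≟_ to _≟ℕ_)
open import Data.Fin using (Fin; zero; suc)
open import Data.Fin.Properties using (¬∀⟶∃¬; suc-injective) renaming (_≟_ to _≟ᶠ_)
open import Data.Vec using (Vec; []; _∷_; lookup; tabulate)
open import Data.Vec.Properties using (lookup∘tabulate)
open import Data.Product using (Σ; ∃; _×_; _,_; proj₁; proj₂)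
open import Data.Sum using (_⊎_; inj₁; inj₂)
open import Data.Unit using (tt)
open import Data.Empty using (⊥; ⊥-elim)
open import Relation.Binary.PropositionalEquality using (_≡_; _≢_; refl; sym; cong)
open import Relation.Nullary using (yes; no; does)
open import Relation.Nullary.Decidable using (decidable-stable)
open import Data.Bool using (if_then_else_)
open import Function.Bundles using (_⇔_; mk⇔; Equivalence)

open Equivalence using (to; from)

∨ℕ≡0⇔ : ∀ a b → a ∨ℕ b ≡ 0 ⇔ (a ≡ 0 × b ≡ 0)
∨ℕ≡0⇔ a b = mk⇔ (split a b) (λ { (refl , refl) → refl })
  where
  split : ∀ a b → a ∨ℕ b ≡ 0 → a ≡ 0 × b ≡ 0
  split zero zero _ = refl , refl

∧ℕ≡0⇔ : ∀ a b → a ∧ℕ b ≡ 0 ⇔ (a ≡ 0 ⊎ b ≡ 0)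
∧ℕ≡0⇔ a b = mk⇔ (split a b) (join a b)
  where
  split : ∀ a b → a ∧ℕ b ≡ 0 → a ≡ 0 ⊎ b ≡ 0
  split zero    _    _ = inj₁ refl
  split (suc _) zero _ = inj₂ refl
  join : ∀ a b → a ≡ 0 ⊎ b ≡ 0 → a ∧ℕ b ≡ 0
  join zero    _    _ = refl
  join (suc _) zero _ = refl
  join (suc _) (suc _) (inj₁ ())
  join (suc _) (suc _) (inj₂ ())

⋁≡0⇔ : ∀ n (f : Fin n → ℕ) → ⋁ n f ≡ 0 ⇔ (∀ i → f i ≡ 0)
⋁≡0⇔ n f = mk⇔ (allZero n f) (joinZero n f)
  where
  allZero : ∀ n (f : Fin n → ℕ) → ⋁ n f ≡ 0 → ∀ i → f i ≡ 0
  allZero (suc n) f e zero    = proj₁ (to (∨ℕ≡0⇔ _ _) e)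
  allZero (suc n) f e (suc i) =
    allZero n (λ i → f (suc i)) (proj₂ (to (∨ℕ≡0⇔ _ _) e)) i
  joinZero : ∀ n (f : Fin n → ℕ) → (∀ i → f i ≡ 0) → ⋁ n f ≡ 0
  joinZero zero    f _ = refl
  joinZero (suc n) f z =
    from (∨ℕ≡0⇔ _ _) (z zero , joinZero n (λ i → f (suc i)) (λ i → z (suc i)))

⋁≢0⇒∃≢0 : ∀ n (f : Fin n → ℕ) → ⋁ n f ≢ 0 → ∃ λ i → f i ≢ 0
⋁≢0⇒∃≢0 n f ne = ¬∀⟶∃¬ n _ (λ i → f i ≟ℕ 0) (λ z → ne (from (⋁≡0⇔ n f) z))

AtMostOneNonzero : ∀ {n} → Vec ℕ n → Set
AtMostOneNonzero {n} xs = ∀ (i j : Fin n) → i ≢ j → lookup xs i ≡ 0 ⊎ lookup xs j ≡ 0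

⋁pairs≡0⇔ : ∀ {n} (xs : Vec ℕ n) → ⋁pairs xs ≡ 0 ⇔ AtMostOneNonzero xs
⋁pairs≡0⇔ {n} xs = mk⇔ pairsZero⇒atMostOne atMostOne⇒pairsZero
  where
  pairsZero⇒atMostOne : ⋁pairs xs ≡ 0 → AtMostOneNonzero xs
  pairsZero⇒atMostOne e i j i≢j
    with to (⋁≡0⇔ n _) (to (⋁≡0⇔ n _) e i) j
  ... | eᵢⱼ with i ≟ᶠ j
  ... | yes i≡j = ⊥-elim (i≢j i≡j)
  ... | no _    = to (∧ℕ≡0⇔ _ _) eᵢⱼ

  -- Contrapositively: a non-zero join exhibits a pair i ≠ j of non-zero entries.
  atMostOne⇒pairsZero : AtMostOneNonzero xs → ⋁pairs xs ≡ 0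
  atMostOne⇒pairsZero h = decidable-stable (⋁pairs xs ≟ℕ 0) refute
    where
    refute : ⋁pairs xs ≢ 0 → ⊥
    refute ne with ⋁≢0⇒∃≢0 n _ ne
    ... | i , neᵢ with ⋁≢0⇒∃≢0 n _ neᵢ
    ... | j , neᵢⱼ with i ≟ᶠ j
    ... | yes _   = neᵢⱼ refl
    ... | no i≢j  = neᵢⱼ (from (∧ℕ≡0⇔ _ _) (h i j i≢j))

-- ℶ₂(x), i.e. min(x+1,2) = x+1, says that x is a bit 0 or 1.
Bit : ℕ → Set
Bit x = suc x ⊓ 2 ≡ suc x

δ : ∀ {n} → Fin n → Fin n → ℕ
δ i j = if does (i ≟ᶠ j) then 1 else 0

δ-bit : ∀ {n} (i j : Fin n) → Bit (δ i j)
δ-bit i j with i ≟ᶠ j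
... | yes _ = refl
... | no  _ = refl

δ-off : ∀ {n} {i j : Fin n} → i ≢ j → δ i j ≡ 0
δ-off {i = i} {j} i≢j with i ≟ᶠ j
... | yes i≡j = ⊥-elim (i≢j i≡j)
... | no  _   = refl

indicator : ∀ {n} → Fin n → Vec ℕ n
indicator j = tabulate (λ i → δ i j)

indicator-atMostOne : ∀ {n} (j : Fin n) → AtMostOneNonzero (indicator j)
indicator-atMostOne j i i′ i≢i′ rewrite lookup∘tabulate (λ i → δ i j) i
                                      | lookup∘tabulate (λ i → δ i j) i′
  with i ≟ᶠ j
... | yes refl = inj₂ (δ-off (λ i′≡i → i≢i′ (sym i′≡i)))
... | no _     = inj₁ refl

-- If P holds at one of any two distinct indices, it fails at most at one
-- index j (on Fin (suc n) such an index can always be named).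
allButOne : ∀ n (P : Fin (suc n) → Set) →
  (∀ i j → i ≢ j → P i ⊎ P j) → Σ (Fin (suc n)) λ j → ∀ i → i ≢ j → P i
allButOne zero    P h = zero , λ { zero z≢z → ⊥-elim (z≢z refl) }
allButOne (suc n) P h
  with allButOne n (λ i → P (suc i))
                   (λ i j i≢j → h (suc i) (suc j) (λ e → i≢j (suc-injective e)))
... | j , Pₜₐᵢₗ with h zero (suc j) (λ ())
...   | inj₁ P₀ = suc j , λ { zero _ → P₀ ; (suc i) i≢j → Pₜₐᵢₗ i (λ e → i≢j (cong suc e)) }
...   | inj₂ Pⱼ = zero , λ { zero z≢z → ⊥-elim (z≢z refl) ; (suc i) _ → atTail i }
  where
  -- P (suc j) holds, and off j the tail already satisfies P.
  atTail : ∀ i → P (suc i)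
  atTail i with i ≟ᶠ j
  ... | yes refl = Pⱼ
  ... | no i≢j   = Pₜₐᵢₗ i i≢j

module _ (⫫ : Process → Set) where
  open Realizability ⫫
  open Aleph ⫫

  -- A realizer of ⊥ realizes every formula, since ‖A‖ ⊆ Π = ‖⊥‖.
  ⊥-realizes : ∀ (A : FV) {t} → ∣ ‖⊥‖ ∣ t → ∣ A ∣ t
  ⊥-realizes A r π _ = r π tt

  -- For x = 0 the falsity value of x ≠ 0 is Π, so its realizers realize ⊥.
  ≠0-at-zero : ∀ {x t} → x ≡ 0 → ∣ ≠ x 0 ∣ t → ∣ ‖⊥‖ ∣ t
  ≠0-at-zero x≡0 r π _ = r π (x≡0 , tt)

  -- For x ≠ 0 the falsity value of x ≠ 0 is empty: every term realizes it.
  ≠0-at-nonzero : ∀ {x t} → x ≢ 0 → ∣ ≠ x 0 ∣ t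
  ≠0-at-nonzero x≢0 _ (x≡0 , _) = ⊥-elim (x≢0 x≡0)

  ∀ₓⁿ⇔ : ∀ n (F : Vec ℕ n → FV) π → ∀ₓⁿ n F π ⇔ Σ (Vec ℕ n) λ xs → F xs π
  ∀ₓⁿ⇔ n F π = mk⇔ (out n F) (into n F)
    where
    out : ∀ n (F : Vec ℕ n → FV) → ∀ₓⁿ n F π → Σ (Vec ℕ n) λ xs → F xs π
    out zero    F h       = [] , h
    out (suc n) F (m , h) with out n (λ xs → F (m ∷ xs)) h
    ... | xs , p = m ∷ xs , p
    into : ∀ n (F : Vec ℕ n → FV) → Σ (Vec ℕ n) (λ xs → F xs π) → ∀ₓⁿ n F π
    into zero    F ([] , h)     = h
    into (suc n) F (x ∷ xs , h) = x , into n (λ ys → F (x ∷ ys)) (xs , h)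

  hooks⇔ : ∀ {n} (xs : Vec ℕ n) B π → hooks xs B π ⇔ ((∀ i → Bit (lookup xs i)) × B π)
  hooks⇔ xs B π = mk⇔ (out xs) (into xs)
    where
    out : ∀ {n} (xs : Vec ℕ n) → hooks xs B π → (∀ i → Bit (lookup xs i)) × B π
    out []       h       = (λ ()) , h
    out (x ∷ xs) (b , h) with out xs h
    ... | bs , p = (λ { zero → b ; (suc i) → bs i }) , p
    into : ∀ {n} (xs : Vec ℕ n) → (∀ i → Bit (lookup xs i)) × B π → hooks xs B π
    into []       (_ , h)  = h
    into (x ∷ xs) (bs , h) = bs zero , into xs ((λ i → bs (suc i)) , h)

  arrows⇔ : ∀ {n} (xs : Vec ℕ n) C (ts : Vec Λ n) π →
    arrows xs C (pushAll ts π) ⇔ ((∀ i → ∣ ≠ (lookup xs i) 0 ∣ (lookup ts i)) × C π)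
  arrows⇔ xs C ts π = mk⇔ (out xs ts) (into xs ts)
    where
    out : ∀ {n} (xs : Vec ℕ n) (ts : Vec Λ n) → arrows xs C (pushAll ts π) →
      (∀ i → ∣ ≠ (lookup xs i) 0 ∣ (lookup ts i)) × C π
    out []       []       h       = (λ ()) , h
    out (x ∷ xs) (t ∷ ts) (r , h) with out xs ts h
    ... | rs , c = (λ { zero → r ; (suc i) → rs i }) , c
    into : ∀ {n} (xs : Vec ℕ n) (ts : Vec Λ n) →
      (∀ i → ∣ ≠ (lookup xs i) 0 ∣ (lookup ts i)) × C π → arrows xs C (pushAll ts π)
    into []       []       (_ , c)  = c
    into (x ∷ xs) (t ∷ ts) (rs , c) = rs zero , into xs ts ((λ i → rs (suc i)) , c)

  Witness : ∀ {n} → Vec Λ n → Vec ℕ n → Set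
  Witness ts xs = (∀ i → Bit (lookup xs i))
                × (∀ i → ∣ ≠ (lookup xs i) 0 ∣ (lookup ts i))
                × AtMostOneNonzero xs

  membership : ∀ n (ts : Vec Λ n) π → ‖ℶ₂⊨A‖ n (pushAll ts π) ⇔ Σ (Vec ℕ n) (Witness ts)
  membership n ts π = mk⇔ out into
    where
    Body : Vec ℕ n → FV
    Body xs = hooks xs (arrows xs (≠ (⋁pairs xs) 0))
    out : ‖ℶ₂⊨A‖ n (pushAll ts π) → Σ (Vec ℕ n) (Witness ts)
    out mem with to (∀ₓⁿ⇔ n Body _) mem
    ... | xs , h with to (hooks⇔ xs _ _) h
    ... | bits , h′ with to (arrows⇔ xs _ ts π) h′
    ... | realizers , (pairs≡0 , _) = xs , bits , realizers , to (⋁pairs≡0⇔ xs) pairs≡0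
    into : Σ (Vec ℕ n) (Witness ts) → ‖ℶ₂⊨A‖ n (pushAll ts π)
    into (xs , bits , realizers , atMostOne) =
      from (∀ₓⁿ⇔ n Body _) (xs , from (hooks⇔ xs _ _) (bits ,
        from (arrows⇔ xs _ ts π) (realizers , (from (⋁pairs≡0⇔ xs) atMostOne , tt))))

-- Theorem 9.
mainTheorem9 : (n : ℕ) → 1 ≤ n → (⫫ : Process → Set) → IsPole ⫫ → (ts : Vec Λ n) → (π : Stack) →
    (Aleph.‖ℶ₂⊨A‖ ⫫ n (pushAll ts π)
      ⇔ (∀ (i j : Fin n) → i ≢ j →
           Realizability.∣_∣ ⫫ (Realizability.‖⊥‖ ⫫) (lookup ts i)
           ⊎ Realizability.∣_∣ ⫫ (Realizability.‖⊥‖ ⫫) (lookup ts j)))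
mainTheorem9 (suc n) (s≤s z≤n) ⫫ _ ts π = mk⇔ necessity sufficiency
  where
  open Realizability ⫫
  Pairwise⊥ : Set
  Pairwise⊥ = ∀ i j → i ≢ j → ∣ ‖⊥‖ ∣ (lookup ts i) ⊎ ∣ ‖⊥‖ ∣ (lookup ts j)

  -- Of two distinct bits one is 0, and its term then realizes ⊥.
  necessity : Aleph.‖ℶ₂⊨A‖ ⫫ (suc n) (pushAll ts π) → Pairwise⊥
  necessity mem i j i≢j with to (membership ⫫ (suc n) ts π) mem
  ... | xs , _ , realizers , atMostOne with atMostOne i j i≢j
  ...   | inj₁ xᵢ≡0 = inj₁ (≠0-at-zero ⫫ xᵢ≡0 (realizers i))
  ...   | inj₂ xⱼ≡0 = inj₂ (≠0-at-zero ⫫ xⱼ≡0 (realizers j))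

  -- The indicator vector of the one possibly exceptional index is a witness.
  sufficiency : Pairwise⊥ → Aleph.‖ℶ₂⊨A‖ ⫫ (suc n) (pushAll ts π)
  sufficiency h with allButOne n (λ i → ∣ ‖⊥‖ ∣ (lookup ts i)) h
  ... | j , realize⊥ = from (membership ⫫ (suc n) ts π)
        (indicator j , bits , realizers , indicator-atMostOne j)
    where
    bits : ∀ i → Bit (lookup (indicator j) i)
    bits i rewrite lookup∘tabulate (λ i → δ i j) i = δ-bit i j
    realizers : ∀ i → ∣ ≠ (lookup (indicator j) i) 0 ∣ (lookup ts i)
    realizers i rewrite lookup∘tabulate (λ i → δ i j) i with i ≟ᶠ j
    ... | yes refl = ≠0-at-nonzero ⫫ (λ ())
    ... | no i≢j   = ⊥-realizes ⫫ _ (realize⊥ i i≢j)
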